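{- For every graph $G$ and every positive integer $s$, we have $c_{s,s}(G)\le c(G)$.
   Context: All graphs are finite, undirected and reflexive. In the speed-$(s,s)$ Cops and Robbers game on a graph $G$, the cops first place themselves on vertices, then the robber places himself; play proceeds in rounds, each a cops' turn followed by a robber's turn. On the cops' turn each cop moves along a walk of length at most $s$ (possibly staying put); on the robber's turn he moves along a walk of length at most $s$ not passing through a cop-occupied vertex. The cops win if some cop occupies the robber's vertex; the robber wins if he evades forever. $c_{s,s}(G)$ is the minimum number of cops guaranteeing a win; $c(G)=c_{1,1}(G)$ is the ordinary cop number. -}

module Defs where

open import Data.Nat using (ℕ; zero; suc; _≤_)
open import Data.Fin using (Fin)
open import Data.Unit using (⊤)
open import Data.Product using (Σ; ∃; _×_; _,_)
open import Relation.Nullary using (¬_; Dec)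
open import Relation.Binary.PropositionalEquality using (_≡_)

-- A finite, undirected, reflexive graph on the vertex set Fin n.
-- (Adjacency is a decidable relation; every finite graph is such classically.)
record Graph : Set₁ where
  field
    n     : ℕ
    _~_   : Fin n → Fin n → Set
    ~-dec : ∀ u v → Dec (u ~ v)
    ~-sym : ∀ {u v} → u ~ v → v ~ u
    ~-refl : ∀ u → u ~ u

open Graph public

-- Walk G P m u v : a walk of length at most m from u to v in G,
-- every vertex of which satisfies P.
data Walk (G : Graph) (P : Fin (n G) → Set) : ℕ → Fin (n G) → Fin (n G) → Set where
  here : ∀ {m u} → P u → Walk G P m u u
  step : ∀ {m u w v} → P u → _~_ G u w → Walk G P m w v → Walk G P (suc m) u v


NoCop : (G : Graph) {k : ℕ} → (Fin k → Fin (n G)) → Fin (n G) → Set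
NoCop G {k} C v = ∀ (i : Fin k) → ¬ (C i ≡ v)

-- CopsTurn C r  : it is the cops' turn, cops at C, robber at r; cops can force a capture.
-- RobberTurn C r: it is the robber's turn, cops at C, robber at r; cops can force a capture.
-- Inductive (least fixed point) = cops capture the robber in finitely many rounds
-- against every robber play.
mutual
  data CopsTurn (G : Graph) (s k : ℕ) (C : Fin k → Fin (n G)) (r : Fin (n G)) : Set where
    move : (C' : Fin k → Fin (n G)) →
           (∀ i → Walk G (λ _ → ⊤) s (C i) (C' i)) →
           RobberTurn G s k C' r → CopsTurn G s k C r

  data RobberTurn (G : Graph) (s k : ℕ) (C : Fin k → Fin (n G)) (r : Fin (n G)) : Set where
    caught : (i : Fin k) → C i ≡ r → RobberTurn G s k C r
    evade  : (∀ r' → Walk G (NoCop G C) s r r' → CopsTurn G s k C r') →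
             RobberTurn G s k C r

CopsWin : Graph → ℕ → ℕ → Set
CopsWin G s k = Σ (Fin k → Fin (n G)) λ C → ∀ r → CopsTurn G s k C r

IsCopNumber : Graph → ℕ → ℕ → Set
IsCopNumber G s c = CopsWin G s c × (∀ k → CopsWin G s k → c ≤ k)

{-# OPTIONS --safe #-}
-- The cops replay a winning speed-1 strategy. A speed-s robber move is fed to the
-- speed-1 strategy one edge at a time, and the cops concatenate the strategy's
-- answers; after j of the robber's m ≤ s edges each cop has walked j steps, so the
-- accumulated moves are legal at speed s. Should a replayed cop land on the robber's
-- path, that cop walks its accumulated route followed by the rest of the path,
-- at most s steps in total, and catches the robber at his destination.
module Submission where

open import Defs
open import Data.Nat using (ℕ; _≤_; _≥_; _+_; s≤s)
open import Data.Nat.Properties using (≤-refl; ≤-trans; ≤-reflexive; m≤m+n; m≤n+m; n≤1+n; +-monoʳ-≤; +-assoc)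
open import Data.Product using (Σ; ∃; _×_; _,_)
open import Data.Sum using (_⊎_; inj₁; inj₂)
open import Data.Fin using (Fin; _≟_)
open import Data.Fin.Properties using (any?)
open import Data.Vec.Functional using (updateAt)
open import Data.Vec.Functional.Properties using (updateAt-updates; updateAt-minimal)
open import Data.Unit using (⊤; tt)
open import Function using (const)
open import Relation.Nullary using (yes; no)
open import Relation.Binary.PropositionalEquality using (_≡_; refl; sym; subst)

module _ {G : Graph} where

  lengthen : ∀ {P m m′ u v} → m ≤ m′ → Walk G P m u v → Walk G P m′ u v
  lengthen _          (here p)     = here p
  lengthen (s≤s m≤m′) (step p e w) = step p e (lengthen m≤m′ w)

  _++_ : ∀ {P a b u v w} → Walk G P a u v → Walk G P b v w → Walk G P (a + b) u w
  _++_ {a = a} {b} (here _) w = lengthen (m≤n+m b a) w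
  step p e w₁ ++ w₂ = step p e (w₁ ++ w₂)

  map : ∀ {P Q m u v} → (∀ {x} → P x → Q x) → Walk G P m u v → Walk G Q m u v
  map f (here p)     = here (f p)
  map f (step p e w) = step (f p) e (map f w)

  head : ∀ {P m u v} → Walk G P m u v → P u
  head (here p)     = p
  head (step p _ _) = p

module SpeedUp (G : Graph) {s : ℕ} (1≤s : 1 ≤ s) {k : ℕ} where

  V : Set
  V = Fin (n G)

  Cops : Set
  Cops = Fin k → V

  CopWalk : ℕ → V → V → Set
  CopWalk = Walk G (λ _ → ⊤)

  copAt⊎NoCop : (D : Cops) (x : V) → (∃ λ i → D i ≡ x) ⊎ NoCop G D x
  copAt⊎NoCop D x with any? (λ i → D i ≟ x)
  ... | yes cop = inj₁ cop
  ... | no ¬cop = inj₂ (λ i Di≡x → ¬cop (i , Di≡x))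

  catchWith : ∀ {E : Cops} {r} (i : Fin k) → CopWalk s (E i) r → CopsTurn G s k E r
  catchWith {E} {r} i w = move E′ walks (caught i (updateAt-updates i E))
    where
    E′ : Cops
    E′ = updateAt E i (const r)

    walks : ∀ i′ → CopWalk s (E i′) (E′ i′)
    walks i′ with i′ ≟ i
    ... | yes refl = subst (CopWalk s (E i)) (sym (updateAt-updates i E)) w
    ... | no i′≢i  = subst (CopWalk s (E i′)) (sym (updateAt-minimal i′ i E i′≢i)) (here tt)

  catchVia : ∀ {P} {E D : Cops} {j m x r} → (∀ i → CopWalk j (E i) (D i)) → (i : Fin k) → D i ≡ x →
             Walk G P m x r → j + m ≤ s → CopsTurn G s k E r
  catchVia lag i refl w j+m≤s = catchWith i (lengthen j+m≤s (lag i ++ map (const tt) w))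

  mutual
    copsSpeedUp : ∀ {C r} → CopsTurn G 1 k C r → CopsTurn G s k C r
    copsSpeedUp (move C′ ws t) = move C′ (λ i → lengthen 1≤s (ws i)) (robberSpeedUp t)

    robberSpeedUp : ∀ {C r} → RobberTurn G 1 k C r → RobberTurn G s k C r
    robberSpeedUp (caught i Ci≡r) = caught i Ci≡r
    robberSpeedUp (evade f)       = evade (λ _ w → replay f w ≤-refl)

    replay : ∀ {C r r′ m} → (∀ y → Walk G (NoCop G C) 1 r y → CopsTurn G 1 k C y) →
             Walk G (NoCop G C) m r r′ → m ≤ s → CopsTurn G s k C r′
    replay f (here p)          _   = copsSpeedUp (f _ (here p))
    replay f (step p r~y rest) m≤s with f _ (step p r~y (here (head rest)))
    ... | move D ws t = pursue ws t rest m≤s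

    -- E: the cops' actual positions; D: where the replayed speed-1 strategy has
    -- taken them after j rounds; the robber still has the m edges of the walk to go.
    pursue : ∀ {P} {E D : Cops} {j m x r} → (∀ i → CopWalk j (E i) (D i)) → RobberTurn G 1 k D x →
             Walk G P m x r → j + m ≤ s → CopsTurn G s k E r
    pursue {D = D} {j} {m} lag t (here _) j+m≤s =
      move D (λ i → lengthen (≤-trans (m≤m+n j m) j+m≤s) (lag i)) (robberSpeedUp t)
    pursue lag (caught i Di≡x) w j+m≤s = catchVia lag i Di≡x w j+m≤s
    pursue {D = D} {j} {x = x} lag (evade f) w@(step {m = m} {w = y} _ x~y rest) j+m≤s
      with copAt⊎NoCop D x | copAt⊎NoCop D y
    ... | inj₁ (i , Di≡x) | _ = catchVia lag i Di≡x w j+m≤s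
    ... | inj₂ _ | inj₁ (i , Di≡y) =
      catchVia lag i Di≡y rest (≤-trans (+-monoʳ-≤ j (n≤1+n m)) j+m≤s)
    ... | inj₂ x-free | inj₂ y-free with f y (step x-free x~y (here y-free))
    ...   | move D′ ws t′ =
      pursue (λ i → lag i ++ ws i) t′ rest (≤-trans (≤-reflexive (+-assoc j 1 m)) j+m≤s)

  copsWin-speedUp : CopsWin G 1 k → CopsWin G s k
  copsWin-speedUp (C , win) = C , λ r → copsSpeedUp (win r)

corollary2p9 : (G : Graph) (s : ℕ) → s ≥ 1 →
               (c : ℕ) → IsCopNumber G 1 c →
               Σ ℕ (λ k → k ≤ c × CopsWin G s k)
corollary2p9 G s s≥1 c (c-cops-win , _) =
  c , ≤-refl , SpeedUp.copsWin-speedUp G s≥1 c-cops-win
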